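{- Let $m\ge 3$, $n$ and $t$ be positive integers with $n\ge t-1$ and $t\ge 4$. Then $dyn_t(C_m\Box K_n)=m(t-2)$.
   Context: $C_m$ is the cycle on $m$ vertices and $K_n$ the complete graph on $n$ vertices; $G\Box H$ is the Cartesian product (vertex set $V(G)\times V(H)$, $(u,v)\sim(u',v')$ iff $u=u'$ and $vv'\in E(H)$, or $v=v'$ and $uu'\in E(G)$). For constant threshold $t$, a set $D$ of vertices is a $t$-dynamic monopoly if starting from $D$ and repeatedly adding any vertex having at least $t$ neighbors in the current set eventually yields all vertices; $dyn_t(G)$ is the minimum size of a $t$-dynamic monopoly. -}

module Defs where

open import Data.Nat using (ℕ; zero; suc; _≡ᵇ_; _*_; _≤ᵇ_)
open import Data.Bool using (Bool; true; false; _∧_; _∨_; not; if_then_else_)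
open import Data.Fin using (Fin; toℕ; remQuot; _≟_)
open import Data.Fin.Subset using (Subset; ∣_∣; _∩_; _∪_)
open import Data.Vec using (tabulate; lookup)
open import Data.Product using (_,_)
open import Relation.Nullary.Decidable using (⌊_⌋)

record Graph : Set where
  field
    V   : ℕ
    adj : Fin V → Fin V → Bool
open Graph public

-- The cycle C_m on vertices 0,…,m-1: i ~ j iff j = i+1 or i = j+1 (mod m).
-- (Intended for m ≥ 3.)
cycleAdj : (m : ℕ) → Fin m → Fin m → Bool
cycleAdj m i j =
  (suc (toℕ i) ≡ᵇ toℕ j) ∨ (suc (toℕ j) ≡ᵇ toℕ i)
  ∨ ((toℕ i ≡ᵇ 0) ∧ (suc (toℕ j) ≡ᵇ m))
  ∨ ((toℕ j ≡ᵇ 0) ∧ (suc (toℕ i) ≡ᵇ m))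

C : ℕ → Graph
C m = record { V = m ; adj = cycleAdj m }

K : ℕ → Graph
K n = record { V = n ; adj = λ i j → not ⌊ i ≟ j ⌋ }

-- Cartesian product G □ H, vertex set Fin (V G * V H) ≅ Fin (V G) × Fin (V H)
-- via remQuot.
_□_ : Graph → Graph → Graph
G □ H = record { V = V G * V H ; adj = a }
  where
  a : Fin (V G * V H) → Fin (V G * V H) → Bool
  a x y with remQuot (V H) x | remQuot (V H) y
  ... | (u , v) | (u' , v') =
    (⌊ u ≟ u' ⌋ ∧ adj H v v') ∨ (⌊ v ≟ v' ⌋ ∧ adj G u u')

nbhd : (G : Graph) → Fin (V G) → Subset (V G)
nbhd G v = tabulate (adj G v)

step : (G : Graph) → ℕ → Subset (V G) → Subset (V G)
step G t S = tabulate λ v → lookup S v ∨ (t ≤ᵇ ∣ S ∩ nbhd G v ∣)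

iterate : {A : Set} → (A → A) → ℕ → A → A
iterate f zero    x = x
iterate f (suc k) x = f (iterate f k x)

-- Final set of the process started from D.  The process is monotone and
-- each non-stationary round adds a vertex, so V G rounds reach the
-- stable set ("eventually").
closure : (G : Graph) → ℕ → Subset (V G) → Subset (V G)
closure G t D = iterate (step G t) (V G) D

IsDynMonopoly : (G : Graph) → ℕ → Subset (V G) → Set
IsDynMonopoly G t D = ∀ v → lookup (closure G t D) v ≡ true
  where open import Relation.Binary.PropositionalEquality using (_≡_)

open import Data.Product using (Σ; _×_)
open import Data.Nat using (_≤_)
open import Relation.Binary.PropositionalEquality using (_≡_)

DynEq : (G : Graph) → (t k : ℕ) → Set
DynEq G t k =
  (Σ (Subset (V G)) λ D → IsDynMonopoly G t D × ∣ D ∣ ≡ k)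
  × (∀ D → IsDynMonopoly G t D → k ≤ ∣ D ∣)

-- Write t = 4 + s and view C_m □ K_n as m rows, copies of K_n, joined along columns into cycles.
-- A vertex outside a set S has at most |S ∩ its row| neighbours in S inside its row and at most
-- two in its column.  Hence a row containing fewer than t - 2 vertices of S never gains a vertex,
-- and having n ≥ t - 2 vertices it never becomes full: every t-dynamic monopoly meets each row in
-- at least t - 2 vertices.  Conversely colour row 0 as the origin and the other rows by parity, so
-- that adjacent rows get different colours, and seed t - 2 columns of each row: {0,…,s+1} in row 0,
-- {0,…,s} ∪ {s+2} in odd rows and {0,…,s-1} ∪ {s+1, n-1} in even rows.  In the first round odd
-- rows gain column s+1 and even rows column s (both neighbouring rows contain it), in the second
-- odd rows gain n-1 and even rows s+2 (t - 1 vertices in the row and one neighbouring row).  Then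
-- every nonzero row is full or contains t vertices, so it fills in the third round, and row 0
-- fills in the fourth.

module Submission where

open import Data.Bool using (Bool; true; false; _∧_; _∨_; not)
open import Data.Bool.Properties using (∨-identityʳ; ∨-zeroʳ; ∧-comm; ∧-zeroʳ; ∧-assoc; T-≡; ¬-not)
open import Data.Empty using (⊥-elim)
open import Data.Fin using (Fin; zero; suc; toℕ; combine; remQuot; fromℕ<; _↑ˡ_; _↑ʳ_; _≟_)
import Data.Fin.Properties as Fin
open import Data.Fin.Properties using (remQuot-combine; combine-remQuot; toℕ<n; toℕ-fromℕ<)
open import Data.Fin.Subset using (Subset; ∣_∣; _∩_)
open import Data.Nat using (ℕ; zero; suc; _+_; _*_; _∸_; _≤_; _<_; z≤n; s≤s; _≡ᵇ_; _<ᵇ_; _≤ᵇ_)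
open import Data.Nat.Properties
  using ( +-0-commutativeMonoid; +-assoc; +-comm; +-identityʳ; +-suc; +-mono-≤; *-identityʳ; *-mono-≤
        ; ≤-refl; ≤-reflexive; ≤-trans; ≤-<-trans; <-trans; <-irrefl; ≤-pred; n≤1+n; n<1+n; m≤n+m
        ; <⇒≤; <⇒≱; ≤⇒≯; >⇒≢; ≮⇒≥; ≰⇒>; ≤∧≢⇒<; m<1+n⇒m<n∨m≡n; m∸n+n≡m; 1+n≢n; suc-injective
        ; _≤?_; _<?_; ≡ᵇ⇒≡; ≡⇒≡ᵇ; <ᵇ⇒<; <⇒<ᵇ; ≤ᵇ⇒≤; ≤⇒≤ᵇ; module ≤-Reasoning )
  renaming (_≟_ to _≟ℕ_)
open import Algebra.Properties.CommutativeMonoid.Sum +-0-commutativeMonoid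
  using (sum; sum-cong-≗; ∑-distrib-+; sum-replicate-zero)
open import Data.Product using (Σ; _×_; _,_; uncurry)
open import Data.Sum using (_⊎_; inj₁; inj₂)
open import Data.Vec using ([]; _∷_; lookup; tabulate)
open import Data.Vec.Properties using (lookup∘tabulate; lookup-zipWith)
open import Function using (_∘_)
open import Function.Bundles using (Equivalence)
open import Relation.Binary.PropositionalEquality
open import Relation.Nullary using (¬_; yes; no; contradiction)
open import Relation.Nullary.Decidable using (⌊_⌋)

open import Defs

indicator : Bool → ℕ
indicator true  = 1
indicator false = 0

count : ∀ {k} → (Fin k → Bool) → ℕ
count p = sum (indicator ∘ p)

sum-mono-≤ : ∀ {k} {f g : Fin k → ℕ} → (∀ i → f i ≤ g i) → sum f ≤ sum g
sum-mono-≤ {zero}  f≤g = z≤n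
sum-mono-≤ {suc k} f≤g = +-mono-≤ (f≤g zero) (sum-mono-≤ (f≤g ∘ suc))

sum-single : ∀ {k} (f : Fin k → ℕ) i → (∀ j → j ≢ i → f j ≡ 0) → sum f ≡ f i
sum-single {suc k} f zero    f≡0 =
  trans (cong (f zero +_) (trans (sum-cong-≗ (λ j → f≡0 (suc j) λ ())) (sum-replicate-zero k)))
        (+-identityʳ (f zero))
sum-single {suc k} f (suc i) f≡0 = trans (cong (_+ sum (f ∘ suc)) (f≡0 zero λ ()))
  (sum-single (f ∘ suc) i (λ j j≢i → f≡0 (suc j) (j≢i ∘ Fin.suc-injective)))

sum-↑ : ∀ a b (f : Fin (a + b) → ℕ) → sum f ≡ sum (λ i → f (i ↑ˡ b)) + sum (λ j → f (a ↑ʳ j))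
sum-↑ zero    b f = refl
sum-↑ (suc a) b f = trans (cong (f zero +_) (sum-↑ a b (f ∘ suc))) (sym (+-assoc (f zero) _ _))

sum-combine : ∀ m n (f : Fin (m * n) → ℕ) → sum f ≡ sum {m} (λ u → sum {n} (λ v → f (combine u v)))
sum-combine zero    n f = refl
sum-combine (suc m) n f =
  trans (sum-↑ n (m * n) f) (cong (sum (λ v → f (v ↑ˡ m * n)) +_) (sum-combine m n (f ∘ (n ↑ʳ_))))

count-cong : ∀ {k} {p q : Fin k → Bool} → (∀ i → p i ≡ q i) → count p ≡ count q
count-cong p≗q = sum-cong-≗ (cong indicator ∘ p≗q)

count-mono : ∀ {k} {p q : Fin k → Bool} → (∀ i → p i ≡ true → q i ≡ true) → count p ≤ count q
count-mono {p = p} {q} p⊆q = sum-mono-≤ λ i → indicator-mono (p i) (q i) (p⊆q i)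
  where
  indicator-mono : ∀ a b → (a ≡ true → b ≡ true) → indicator a ≤ indicator b
  indicator-mono false b _   = z≤n
  indicator-mono true  b a⇒b rewrite a⇒b refl = ≤-refl

count-false : ∀ k → count {k} (λ _ → false) ≡ 0
count-false = sum-replicate-zero

count-pos : ∀ {k} (p : Fin k → Bool) i → p i ≡ true → 1 ≤ count p
count-pos p zero    pi rewrite pi = s≤s z≤n
count-pos p (suc i) pi = ≤-trans (count-pos (p ∘ suc) i pi) (m≤n+m _ (indicator (p zero)))

∣∣≡count : ∀ {k} (S : Subset k) → ∣ S ∣ ≡ count (lookup S)
∣∣≡count []          = refl
∣∣≡count (true ∷ S)  = cong suc (∣∣≡count S)
∣∣≡count (false ∷ S) = ∣∣≡count S

sum-const : ∀ k c → sum {k} (λ _ → c) ≡ k * c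
sum-const zero    c = refl
sum-const (suc k) c = cong (c +_) (sum-const k c)

⌊≟⌋-refl : ∀ {k} (i : Fin k) → ⌊ i ≟ i ⌋ ≡ true
⌊≟⌋-refl i = cong ⌊_⌋ (≡-≟-identity _≟_ refl)

⌊≟⌋-≢ : ∀ {k} {i j : Fin k} → i ≢ j → ⌊ i ≟ j ⌋ ≡ false
⌊≟⌋-≢ i≢j = cong ⌊_⌋ (≢-≟-identity _≟_ i≢j)

count-≟ : ∀ {k} (i : Fin k) (p : Fin k → Bool) → count (λ j → ⌊ i ≟ j ⌋ ∧ p j) ≡ indicator (p i)
count-≟ i p = trans (sum-single _ i λ j j≢i → cong (λ b → indicator (b ∧ p j)) (⌊≟⌋-≢ (j≢i ∘ sym)))
                    (cong (λ b → indicator (b ∧ p i)) (⌊≟⌋-refl i))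

≡ᵇ-true : ∀ {i j} → i ≡ j → (i ≡ᵇ j) ≡ true
≡ᵇ-true {i} {j} i≡j = Equivalence.to T-≡ (≡⇒≡ᵇ i j i≡j)

≡ᵇ-sound : ∀ {i j} → (i ≡ᵇ j) ≡ true → i ≡ j
≡ᵇ-sound {i} {j} e = ≡ᵇ⇒≡ i j (Equivalence.from T-≡ e)

≡ᵇ-false : ∀ {i j} → i ≢ j → (i ≡ᵇ j) ≡ false
≡ᵇ-false i≢j = ¬-not (i≢j ∘ ≡ᵇ-sound)

<ᵇ-true : ∀ {i j} → i < j → (i <ᵇ j) ≡ true
<ᵇ-true i<j = Equivalence.to T-≡ (<⇒<ᵇ i<j)

<ᵇ-sound : ∀ {i j} → (i <ᵇ j) ≡ true → i < j
<ᵇ-sound {i} {j} e = <ᵇ⇒< i j (Equivalence.from T-≡ e)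

<ᵇ-false : ∀ {i j} → ¬ i < j → (i <ᵇ j) ≡ false
<ᵇ-false i≮j = ¬-not (i≮j ∘ <ᵇ-sound)

≤ᵇ-true : ∀ {i j} → i ≤ j → (i ≤ᵇ j) ≡ true
≤ᵇ-true i≤j = Equivalence.to T-≡ (≤⇒≤ᵇ i≤j)

≤ᵇ-false : ∀ {i j} → ¬ i ≤ j → (i ≤ᵇ j) ≡ false
≤ᵇ-false {i} {j} i≰j = ¬-not (i≰j ∘ ≤ᵇ⇒≤ i j ∘ Equivalence.from T-≡)

∧-true-left : ∀ {x y} → x ∧ y ≡ true → x ≡ true
∧-true-left {true} _ = refl

count-<ᵇ : ∀ {n} k → k ≤ n → count {n} (λ i → toℕ i <ᵇ k) ≡ k
count-<ᵇ {n} zero    _         = count-false n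
count-<ᵇ     (suc k) (s≤s k≤n) = cong suc (count-<ᵇ k k≤n)

count-∨-≡ᵇ : ∀ {n} (P : ℕ → Bool) j → j < n → P j ≡ false →
             count {n} (λ i → P (toℕ i) ∨ (toℕ i ≡ᵇ j)) ≡ suc (count {n} (P ∘ toℕ))
count-∨-≡ᵇ {suc n} P zero    _         Pj rewrite Pj =
  cong suc (count-cong {n} λ i → ∨-identityʳ (P (suc (toℕ i))))
count-∨-≡ᵇ {suc n} P (suc j) (s≤s j<n) Pj rewrite ∨-identityʳ (P 0) =
  trans (cong (indicator (P 0) +_) (count-∨-≡ᵇ {n} (P ∘ suc) j j<n Pj)) (+-suc (indicator (P 0)) _)

initialWith : ℕ → ℕ → ℕ → Bool
initialWith k j i = (i <ᵇ k) ∨ (i ≡ᵇ j)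

initialWith-true : ∀ {k j i} → i < k ⊎ i ≡ j → initialWith k j i ≡ true
initialWith-true (inj₁ i<k) rewrite <ᵇ-true i<k = refl
initialWith-true {k} {i = i} (inj₂ refl) rewrite ≡ᵇ-true (refl {x = i}) = ∨-zeroʳ (i <ᵇ k)

initialWith-cases : ∀ k j i → initialWith k j i ≡ true → i < k ⊎ i ≡ j
initialWith-cases k j i in-k with i <ᵇ k in i<k
... | true  = inj₁ (<ᵇ-sound i<k)
... | false = inj₂ (≡ᵇ-sound in-k)

initialWith-false : ∀ {k j i} → k ≤ i → i ≢ j → initialWith k j i ≡ false
initialWith-false k≤i i≢j rewrite <ᵇ-false (≤⇒≯ k≤i) | ≡ᵇ-false i≢j = refl

<2+-skip : ∀ {i k} → i < 2 + k → i ≢ k → i < k ⊎ i ≡ 1 + k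
<2+-skip i<2+k i≢k with m<1+n⇒m<n∨m≡n i<2+k
... | inj₂ i≡1+k = inj₂ i≡1+k
... | inj₁ i<1+k with m<1+n⇒m<n∨m≡n i<1+k
...   | inj₁ i<k = inj₁ i<k
...   | inj₂ i≡k = ⊥-elim (i≢k i≡k)

count-initialWith : ∀ {n} k j → k ≤ j → j < n → count {n} (initialWith k j ∘ toℕ) ≡ suc k
count-initialWith {n} k j k≤j j<n =
  trans (count-∨-≡ᵇ (_<ᵇ k) j j<n (<ᵇ-false (≤⇒≯ k≤j)))
        (cong suc (count-<ᵇ k (≤-trans k≤j (<⇒≤ j<n))))

count-exactly-two : ∀ {k} (P : ℕ → Bool) {x y} → x < k → y < k → x ≢ y → P x ≡ true → P y ≡ true →
                    (∀ b → b < k → P b ≡ true → b ≡ x ⊎ b ≡ y) → count {k} (P ∘ toℕ) ≡ 2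
count-exactly-two {k} P {x} {y} x<k y<k x≢y Px Py only = begin
  count {k} (P ∘ toℕ)
    ≡⟨ count-cong (λ i → P≡pair (toℕ i) (toℕ<n i)) ⟩
  count {k} (λ i → (toℕ i ≡ᵇ x) ∨ (toℕ i ≡ᵇ y))
    ≡⟨ count-∨-≡ᵇ (_≡ᵇ x) y y<k (≡ᵇ-false (x≢y ∘ sym)) ⟩
  suc (count {k} (λ i → false ∨ (toℕ i ≡ᵇ x)))
    ≡⟨ cong suc (count-∨-≡ᵇ (λ _ → false) x x<k refl) ⟩
  suc (suc (count {k} (λ _ → false)))
    ≡⟨ cong (2 +_) (count-false k) ⟩
  2 ∎
  where
  open ≡-Reasoning
  P≡pair : ∀ b → b < k → P b ≡ (b ≡ᵇ x) ∨ (b ≡ᵇ y)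
  P≡pair b b<k with P b in Pb
  ... | true with only b b<k Pb
  ...   | inj₁ refl = sym (cong (_∨ (b ≡ᵇ y)) (≡ᵇ-true (refl {x = b})))
  ...   | inj₂ refl = sym (trans (cong ((b ≡ᵇ x) ∨_) (≡ᵇ-true (refl {x = b}))) (∨-zeroʳ _))
  P≡pair b b<k | false with b ≟ℕ x | b ≟ℕ y
  ... | yes refl | _        = contradiction (trans (sym Px) Pb) λ ()
  ... | no _     | yes refl = contradiction (trans (sym Py) Pb) λ ()
  ... | no b≢x   | no b≢y   rewrite ≡ᵇ-false b≢x | ≡ᵇ-false b≢y = refl

module _ (G H : Graph) where

  □-adj-combine : ∀ u v u' v' → adj (G □ H) (combine u v) (combine u' v')
                  ≡ (⌊ u ≟ u' ⌋ ∧ adj H v v') ∨ (⌊ v ≟ v' ⌋ ∧ adj G u u')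
  □-adj-combine u v u' v' = trans (adj-remQuot (combine u v) (combine u' v'))
    (cong₂ adjacency (remQuot-combine u v) (remQuot-combine u' v'))
    where
    adjacency : Fin (V G) × Fin (V H) → Fin (V G) × Fin (V H) → Bool
    adjacency (u , v) (u' , v') = (⌊ u ≟ u' ⌋ ∧ adj H v v') ∨ (⌊ v ≟ v' ⌋ ∧ adj G u u')
    adj-remQuot : ∀ x y → adj (G □ H) x y ≡ adjacency (remQuot (V H) x) (remQuot (V H) y)
    adj-remQuot x y with remQuot {V G} (V H) x | remQuot {V G} (V H) y
    ... | _ | _ = refl

  □-neighbours-in-row : ∀ (w : Fin (V H) → Bool) u v u' → adj G u u ≡ false →
    count (λ v' → w v' ∧ ((⌊ u ≟ u' ⌋ ∧ adj H v v') ∨ (⌊ v ≟ v' ⌋ ∧ adj G u u')))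
    ≡ count (λ v' → w v' ∧ (⌊ u ≟ u' ⌋ ∧ adj H v v')) + indicator (adj G u u' ∧ w v)
  □-neighbours-in-row w u v u' irrefl with u ≟ u'
  ... | yes refl rewrite irrefl =
    trans (count-cong (λ v' → cong (w v' ∧_) (trans (cong (adj H v v' ∨_) (∧-zeroʳ _)) (∨-identityʳ _))))
          (sym (+-identityʳ _))
  ... | no _ = begin
    count (λ v' → w v' ∧ (⌊ v ≟ v' ⌋ ∧ adj G u u'))
      ≡⟨ count-cong (λ v' → trans (∧-comm (w v') _) (∧-assoc ⌊ v ≟ v' ⌋ _ _)) ⟩
    count (λ v' → ⌊ v ≟ v' ⌋ ∧ (adj G u u' ∧ w v'))
      ≡⟨ count-≟ v _ ⟩
    indicator (adj G u u' ∧ w v)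
      ≡⟨ cong (_+ _) (trans (count-cong (λ v' → ∧-zeroʳ (w v'))) (count-false (V H))) ⟨
    count (λ v' → w v' ∧ false) + indicator (adj G u u' ∧ w v)
      ∎
    where open ≡-Reasoning

  □-neighbours : (∀ u → adj G u u ≡ false) → ∀ S u v →
    ∣ S ∩ nbhd (G □ H) (combine u v) ∣ ≡
    count (λ v' → lookup S (combine u v') ∧ adj H v v') + count (λ u' → adj G u u' ∧ lookup S (combine u' v))
  □-neighbours irrefl S u v = begin
    ∣ S ∩ nbhd (G □ H) (combine u v) ∣
      ≡⟨ ∣∣≡count (S ∩ nbhd (G □ H) (combine u v)) ⟩
    count (lookup (S ∩ nbhd (G □ H) (combine u v)))
      ≡⟨ count-cong (λ y → trans (lookup-zipWith _∧_ y S _) (cong (lookup S y ∧_) (lookup∘tabulate _ y))) ⟩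
    count (λ y → lookup S y ∧ adj (G □ H) (combine u v) y)
      ≡⟨ sum-combine (V G) (V H) _ ⟩
    sum (λ u' → count (λ v' → cell u' v' ∧ adj (G □ H) (combine u v) (combine u' v')))
      ≡⟨ sum-cong-≗ (λ u' → trans (count-cong (λ v' → cong (cell u' v' ∧_) (□-adj-combine u v u' v')))
                                  (□-neighbours-in-row (cell u') u v u' (irrefl u))) ⟩
    sum (λ u' → inRow u' + inColumn u')
      ≡⟨ ∑-distrib-+ inRow inColumn ⟩
    sum inRow + sum inColumn
      ≡⟨ cong (_+ sum inColumn) (sum-single inRow u inRow-elsewhere) ⟩
    inRow u + sum inColumn
      ≡⟨ cong (_+ sum inColumn) (count-cong (λ v' → cong (λ b → cell u v' ∧ (b ∧ adj H v v'))
                                                          (⌊≟⌋-refl u))) ⟩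
    count (λ v' → cell u v' ∧ adj H v v') + count (λ u' → adj G u u' ∧ cell u' v)
      ∎
    where
    open ≡-Reasoning
    cell : Fin (V G) → Fin (V H) → Bool
    cell u' v' = lookup S (combine u' v')
    inRow : Fin (V G) → ℕ
    inRow u' = count (λ v' → cell u' v' ∧ (⌊ u ≟ u' ⌋ ∧ adj H v v'))
    inColumn : Fin (V G) → ℕ
    inColumn u' = indicator (adj G u u' ∧ cell u' v)
    inRow-elsewhere : ∀ u' → u' ≢ u → inRow u' ≡ 0
    inRow-elsewhere u' u'≢u = trans (count-cong off-row) (count-false (V H))
      where
      off-row : ∀ v' → (cell u' v' ∧ (⌊ u ≟ u' ⌋ ∧ adj H v v')) ≡ false
      off-row v' = trans (cong (λ b → cell u' v' ∧ (b ∧ adj H v v')) (⌊≟⌋-≢ (u'≢u ∘ sym))) (∧-zeroʳ _)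

-- cycleAdj m i j is definitionally cycleAdjℕ m (toℕ i) (toℕ j).
cycleAdjℕ : ℕ → ℕ → ℕ → Bool
cycleAdjℕ m a b =
  (suc a ≡ᵇ b) ∨ (suc b ≡ᵇ a) ∨ ((a ≡ᵇ 0) ∧ (suc b ≡ᵇ m)) ∨ ((b ≡ᵇ 0) ∧ (suc a ≡ᵇ m))

cycleAdjℕ-cases : ∀ m a b → cycleAdjℕ m a b ≡ true →
  suc a ≡ b ⊎ suc b ≡ a ⊎ (a ≡ 0 × suc b ≡ m) ⊎ (b ≡ 0 × suc a ≡ m)
cycleAdjℕ-cases m a b adj
  with suc a ≡ᵇ b in e₁ | suc b ≡ᵇ a in e₂ | a ≡ᵇ 0 in e₃ | suc b ≡ᵇ m in e₄ | b ≡ᵇ 0 in e₅ | suc a ≡ᵇ m in e₆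
... | true  | _     | _     | _     | _     | _     = inj₁ (≡ᵇ-sound e₁)
... | false | true  | _     | _     | _     | _     = inj₂ (inj₁ (≡ᵇ-sound e₂))
... | false | false | true  | true  | _     | _     = inj₂ (inj₂ (inj₁ (≡ᵇ-sound e₃ , ≡ᵇ-sound e₄)))
... | false | false | true  | false | true  | true  = inj₂ (inj₂ (inj₂ (≡ᵇ-sound e₅ , ≡ᵇ-sound e₆)))
... | false | false | false | _     | true  | true  = inj₂ (inj₂ (inj₂ (≡ᵇ-sound e₅ , ≡ᵇ-sound e₆)))

cycleAdjℕ-suc : ∀ m a → cycleAdjℕ m a (suc a) ≡ true
cycleAdjℕ-suc m a rewrite ≡ᵇ-true (refl {x = a}) = refl

cycleAdjℕ-pred : ∀ m b → cycleAdjℕ m (suc b) b ≡ true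
cycleAdjℕ-pred m b rewrite ≡ᵇ-true (refl {x = b}) = ∨-zeroʳ _

cycleAdjℕ-last : ∀ m b → suc b ≡ m → cycleAdjℕ m 0 b ≡ true
cycleAdjℕ-last m b refl rewrite ≡ᵇ-true (refl {x = b}) = ∨-zeroʳ _

cycleAdjℕ-first : ∀ m a → suc a ≡ m → cycleAdjℕ m a 0 ≡ true
cycleAdjℕ-first m a refl rewrite ≡ᵇ-true (refl {x = a}) =
  trans (cong ((1 ≡ᵇ a) ∨_) (∨-zeroʳ _)) (∨-zeroʳ _)

cycleAdjℕ-irrefl : ∀ {m} → 1 ≢ m → ∀ a → cycleAdjℕ m a a ≡ false
cycleAdjℕ-irrefl {m} 1≢m a = ¬-not (loop ∘ cycleAdjℕ-cases m a a)
  where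
  loop : ¬ (suc a ≡ a ⊎ suc a ≡ a ⊎ (a ≡ 0 × suc a ≡ m) ⊎ (a ≡ 0 × suc a ≡ m))
  loop (inj₁ e)                      = 1+n≢n e
  loop (inj₂ (inj₁ e))               = 1+n≢n e
  loop (inj₂ (inj₂ (inj₁ (refl , e)))) = 1≢m e
  loop (inj₂ (inj₂ (inj₂ (refl , e)))) = 1≢m e

cycleAdjℕ-degree : ∀ {m} → 3 ≤ m → ∀ a → a < m → count {m} (cycleAdjℕ m a ∘ toℕ) ≡ 2
cycleAdjℕ-degree {1} (s≤s ()) zero _
cycleAdjℕ-degree {2} (s≤s (s≤s ())) zero _
cycleAdjℕ-degree {m@(suc (suc (suc k)))} _ zero _ =
  count-exactly-two (cycleAdjℕ m 0) (s≤s (s≤s z≤n)) ≤-refl (λ ())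
    (cycleAdjℕ-suc m 0) (cycleAdjℕ-last m (suc (suc k)) refl) only
  where
  only : ∀ b → b < m → cycleAdjℕ m 0 b ≡ true → b ≡ 1 ⊎ b ≡ suc (suc k)
  only b _ adj with cycleAdjℕ-cases m 0 b adj
  ... | inj₁ e                    = inj₁ (sym e)
  ... | inj₂ (inj₂ (inj₁ (_ , e))) = inj₂ (suc-injective e)
  ... | inj₂ (inj₂ (inj₂ (_ , ())))
cycleAdjℕ-degree {m} 3≤m (suc a) a<m with suc (suc a) ≟ℕ m
... | yes last = count-exactly-two (cycleAdjℕ m (suc a)) (≤-trans (s≤s z≤n) a<m) (<-trans (n<1+n a) a<m) 0≢a
      (cycleAdjℕ-first m (suc a) last) (cycleAdjℕ-pred m a) only
  where
  0≢a : 0 ≢ a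
  0≢a refl = <-irrefl last 3≤m
  only : ∀ b → b < m → cycleAdjℕ m (suc a) b ≡ true → b ≡ 0 ⊎ b ≡ a
  only b b<m adj with cycleAdjℕ-cases m (suc a) b adj
  ... | inj₁ e                    = ⊥-elim (<-irrefl (trans (sym e) last) b<m)
  ... | inj₂ (inj₁ e)             = inj₂ (suc-injective e)
  ... | inj₂ (inj₂ (inj₂ (e , _))) = inj₁ e
... | no notLast = count-exactly-two (cycleAdjℕ m (suc a)) (≤∧≢⇒< a<m notLast) (<-trans (n<1+n a) a<m)
      (λ e → <-irrefl (sym e) (<-trans (n<1+n a) (n<1+n (suc a)))) (cycleAdjℕ-suc m (suc a)) (cycleAdjℕ-pred m a) only
  where
  only : ∀ b → b < m → cycleAdjℕ m (suc a) b ≡ true → b ≡ suc (suc a) ⊎ b ≡ a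
  only b b<m adj with cycleAdjℕ-cases m (suc a) b adj
  ... | inj₁ e                    = inj₁ (sym e)
  ... | inj₂ (inj₁ e)             = inj₂ (suc-injective e)
  ... | inj₂ (inj₂ (inj₂ (_ , e))) = ⊥-elim (notLast e)

data RowType : Set where
  origin odd even : RowType

swap : RowType → RowType
swap origin = origin
swap odd    = even
swap even   = odd

rowType : ℕ → RowType
rowType zero          = origin
rowType (suc zero)    = odd
rowType (suc (suc a)) = swap (rowType (suc a))

swap-involutive : ∀ τ → swap (swap τ) ≡ τ
swap-involutive origin = refl
swap-involutive odd    = refl
swap-involutive even   = refl

rowType-suc≢origin : ∀ a → rowType (suc a) ≢ origin
rowType-suc≢origin zero    ()
rowType-suc≢origin (suc a) with rowType (suc a) | rowType-suc≢origin a
... | origin | ≢origin = ⊥-elim (≢origin refl)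
... | odd    | _       = λ ()
... | even   | _       = λ ()

rowType-suc≢ : ∀ a → rowType a ≢ rowType (suc a)
rowType-suc≢ zero    ()
rowType-suc≢ (suc a) with rowType (suc a) | rowType-suc≢origin a
... | origin | ≢origin = ⊥-elim (≢origin refl)
... | odd    | _       = λ ()
... | even   | _       = λ ()

rowType-proper : ∀ {m} → 1 ≢ m → ∀ a b → cycleAdjℕ m a b ≡ true → rowType a ≢ rowType b
rowType-proper {m} 1≢m a b adj with cycleAdjℕ-cases m a b adj
... | inj₁ refl                           = rowType-suc≢ a
... | inj₂ (inj₁ refl)                    = rowType-suc≢ b ∘ sym
... | inj₂ (inj₂ (inj₁ (refl , 1+b≡m))) with b
...   | zero   = ⊥-elim (1≢m 1+b≡m)
...   | suc b' = rowType-suc≢origin b' ∘ sym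
rowType-proper {m} 1≢m a b adj | inj₂ (inj₂ (inj₂ (refl , 1+a≡m))) with a
...   | zero   = ⊥-elim (1≢m 1+a≡m)
...   | suc a' = rowType-suc≢origin a'

neighbourℕ-of-swapped-type : ∀ {m} → 3 ≤ m → ∀ a → a < m → rowType a ≢ origin →
  Σ ℕ λ b → b < m × cycleAdjℕ m a b ≡ true × rowType b ≡ swap (rowType a)
neighbourℕ-of-swapped-type     _   zero          _   ≢origin = ⊥-elim (≢origin refl)
neighbourℕ-of-swapped-type {m} 3≤m (suc zero)    _   _       = 2 , 3≤m , cycleAdjℕ-suc m 1 , refl
neighbourℕ-of-swapped-type {m} _   (suc (suc a)) a<m _       =
  suc a , <-trans (n<1+n _) a<m , cycleAdjℕ-pred m (suc a) , sym (swap-involutive (rowType (suc a)))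

neighbour-of-swapped-type : ∀ {m} → 3 ≤ m → (u : Fin m) → rowType (toℕ u) ≢ origin →
  Σ (Fin m) λ u' → cycleAdj m u u' ≡ true × rowType (toℕ u') ≡ swap (rowType (toℕ u))
neighbour-of-swapped-type 3≤m u ≢origin with neighbourℕ-of-swapped-type 3≤m (toℕ u) (toℕ<n u) ≢origin
... | b , b<m , adj , type rewrite sym (toℕ-fromℕ< b<m) = fromℕ< b<m , adj , type

step-extensive : ∀ G t S x → lookup S x ≡ true → lookup (step G t S) x ≡ true
step-extensive G t S x Sx rewrite lookup∘tabulate (λ y → lookup S y ∨ (t ≤ᵇ ∣ S ∩ nbhd G y ∣)) x | Sx = refl

iterate-extensive : ∀ G t k S x → lookup S x ≡ true → lookup (iterate (step G t) k S) x ≡ true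
iterate-extensive G t zero    S x Sx = Sx
iterate-extensive G t (suc k) S x Sx = step-extensive G t (iterate (step G t) k S) x (iterate-extensive G t k S x Sx)

iterate-+ : ∀ {A : Set} (f : A → A) j k x → iterate f (j + k) x ≡ iterate f j (iterate f k x)
iterate-+ f zero    k x = refl
iterate-+ f (suc j) k x = cong f (iterate-+ f j k x)

closure-⊇-iterate : ∀ G t k D x → k ≤ V G → lookup (iterate (step G t) k D) x ≡ true →
                    lookup (closure G t D) x ≡ true
closure-⊇-iterate G t k D x k≤V in-k = subst (λ j → lookup (iterate (step G t) j D) x ≡ true) (m∸n+n≡m k≤V)
  (subst (λ S → lookup S x ≡ true) (sym (iterate-+ (step G t) (V G ∸ k) k D))
    (iterate-extensive G t (V G ∸ k) (iterate (step G t) k D) x in-k))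

<∸2⇒+2< : ∀ {c t} → c < t ∸ 2 → c + 2 < t
<∸2⇒+2< {c} {suc (suc t)} c<t = subst (_< suc (suc t)) (+-comm 2 c) (s≤s (s≤s c<t))

module Process (m n t : ℕ) (3≤m : 3 ≤ m) where

  grow : Subset (m * n) → Subset (m * n)
  grow = step (C m □ K n) t

  cell : Subset (m * n) → Fin m → Fin n → Bool
  cell S u v = lookup S (combine u v)

  rowCount columnCount : Subset (m * n) → Fin m → Fin n → ℕ
  rowCount    S u v = count (λ v' → cell S u v' ∧ not ⌊ v ≟ v' ⌋)
  columnCount S u v = count (λ u' → cycleAdj m u u' ∧ cell S u' v)

  RowContains : Subset (m * n) → Fin m → (ℕ → Bool) → Set
  RowContains S u P = ∀ v → P (toℕ v) ≡ true → cell S u v ≡ true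

  1≢m : 1 ≢ m
  1≢m 1≡m = <-irrefl 1≡m (≤-trans (s≤s (s≤s z≤n)) 3≤m)

  cycle-irreflexive : ∀ u → cycleAdj m u u ≡ false
  cycle-irreflexive u = cycleAdjℕ-irrefl 1≢m (toℕ u)

  grow-cell : ∀ S u v → cell (grow S) u v ≡ cell S u v ∨ (t ≤ᵇ rowCount S u v + columnCount S u v)
  grow-cell S u v = trans (lookup∘tabulate _ (combine u v))
    (cong (λ c → cell S u v ∨ (t ≤ᵇ c)) (□-neighbours (C m) (K n) cycle-irreflexive S u v))

  grow-activates : ∀ S u v → t ≤ rowCount S u v + columnCount S u v → cell (grow S) u v ≡ true
  grow-activates S u v t≤ rewrite grow-cell S u v | ≤ᵇ-true t≤ = ∨-zeroʳ _

  grow-idle : ∀ S u v → rowCount S u v + columnCount S u v < t → cell (grow S) u v ≡ cell S u v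
  grow-idle S u v <t rewrite grow-cell S u v | ≤ᵇ-false (<⇒≱ <t) = ∨-identityʳ _

  grow-extensive : ∀ S u v → cell S u v ≡ true → cell (grow S) u v ≡ true
  grow-extensive S u v = step-extensive (C m □ K n) t S (combine u v)

  columnCount≤2 : ∀ S u v → columnCount S u v ≤ 2
  columnCount≤2 S u v = ≤-trans (count-mono {q = cycleAdj m u} (λ _ → ∧-true-left))
                                (≤-reflexive (cycleAdjℕ-degree 3≤m (toℕ u) (toℕ<n u)))

  columnCount-full : ∀ S u v → (∀ u' → cycleAdj m u u' ≡ true → cell S u' v ≡ true) → columnCount S u v ≡ 2
  columnCount-full S u v full = trans (count-cong on-neighbours) (cycleAdjℕ-degree 3≤m (toℕ u) (toℕ<n u))
    where
    on-neighbours : ∀ u' → (cycleAdj m u u' ∧ cell S u' v) ≡ cycleAdj m u u'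
    on-neighbours u' with cycleAdj m u u' in adj
    ... | true  = full u' adj
    ... | false = refl

  columnCount-pos : ∀ S u v u' → cycleAdj m u u' ≡ true → cell S u' v ≡ true → 1 ≤ columnCount S u v
  columnCount-pos S u v u' adj in-S = count-pos _ u' (trans (cong (_∧ cell S u' v) adj) in-S)

  rowCount≤ : ∀ S u v → rowCount S u v ≤ count (cell S u)
  rowCount≤ S u v = count-mono {q = cell S u} (λ _ → ∧-true-left)

  rowCount-≥ : ∀ S u v P → RowContains S u P → cell S u v ≡ false → count {n} (P ∘ toℕ) ≤ rowCount S u v
  rowCount-≥ S u v P P⊆ v∉S = count-mono in-row
    where
    in-row : ∀ v' → P (toℕ v') ≡ true → (cell S u v' ∧ not ⌊ v ≟ v' ⌋) ≡ true
    in-row v' Pv' with v ≟ v'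
    ... | yes refl = contradiction (trans (sym (P⊆ v Pv')) v∉S) λ ()
    ... | no _     = trans (cong (_∧ true) (P⊆ v' Pv')) refl

  grow-fills : ∀ S u v P {c} k → RowContains S u P → count {n} (P ∘ toℕ) ≡ c → k ≤ columnCount S u v →
               t ≤ k + c → cell (grow S) u v ≡ true
  grow-fills S u v P k P⊆ refl k≤ t≤ with cell S u v in v∈S
  ... | true  = grow-extensive S u v v∈S
  ... | false = grow-activates S u v
    (≤-trans t≤ (≤-trans (≤-reflexive (+-comm k _)) (+-mono-≤ (rowCount-≥ S u v P P⊆ v∈S) k≤)))

  row-frozen : ∀ S u → count (cell S u) < t ∸ 2 → ∀ v → cell (grow S) u v ≡ cell S u v
  row-frozen S u small v with cell S u v in v∈S
  ... | true  = grow-extensive S u v v∈S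
  ... | false = trans (grow-idle S u v (≤-<-trans neighbours≤ (<∸2⇒+2< small))) v∈S
    where
    neighbours≤ : rowCount S u v + columnCount S u v ≤ count (cell S u) + 2
    neighbours≤ = +-mono-≤ (rowCount≤ S u v) (columnCount≤2 S u v)

  row-frozen-forever : ∀ D u → count (cell D u) < t ∸ 2 → ∀ k v → cell (iterate grow k D) u v ≡ cell D u v
  row-frozen-forever D u small zero    v = refl
  row-frozen-forever D u small (suc k) v = trans (row-frozen S u still-small v) (row-frozen-forever D u small k v)
    where
    S = iterate grow k D
    still-small : count (cell S u) < t ∸ 2
    still-small = subst (_< t ∸ 2) (sym (count-cong (row-frozen-forever D u small k))) small

  monopoly-row-size : ∀ D → t ∸ 2 ≤ n → IsDynMonopoly (C m □ K n) t D → ∀ u → t ∸ 2 ≤ count (cell D u)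
  monopoly-row-size D t∸2≤n monopoly u with t ∸ 2 ≤? count (cell D u)
  ... | yes large = large
  ... | no  ¬large = contradiction t∸2≤n (<⇒≱ (subst (_< t ∸ 2) row-full small))
    where
    small = ≰⇒> ¬large
    row-full : count (cell D u) ≡ n
    row-full = trans (count-cong (λ v → trans (sym (row-frozen-forever D u small (m * n) v)) (monopoly (combine u v))))
                     (trans (sum-const n 1) (*-identityʳ n))

  ∣∣≡sum-rows : ∀ S → ∣ S ∣ ≡ sum (λ u → count (cell S u))
  ∣∣≡sum-rows S = trans (∣∣≡count S) (sum-combine m n _)

  monopoly-size : ∀ D → t ∸ 2 ≤ n → IsDynMonopoly (C m □ K n) t D → m * (t ∸ 2) ≤ ∣ D ∣
  monopoly-size D t∸2≤n monopoly = begin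
    m * (t ∸ 2)                   ≡⟨ sum-const m (t ∸ 2) ⟨
    sum {m} (λ _ → t ∸ 2)         ≤⟨ sum-mono-≤ (monopoly-row-size D t∸2≤n monopoly) ⟩
    sum (λ u → count (cell D u))  ≡⟨ ∣∣≡sum-rows D ⟨
    ∣ D ∣                         ∎
    where open ≤-Reasoning

-- n = d + 1 and t = 4 + s, so d is the last column.
module Construction (m d s : ℕ) (3≤m : 3 ≤ m) (2+s≤d : 2 + s ≤ d) where
  open Process m (suc d) (4 + s) 3≤m

  seedRow : RowType → ℕ → Bool
  seedRow origin i = i <ᵇ 2 + s
  seedRow odd    i = initialWith (1 + s) (2 + s) i
  seedRow even   i = initialWith s (1 + s) i ∨ (i ≡ᵇ d)

  seedCell : Fin m → Fin (suc d) → Bool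
  seedCell u v = seedRow (rowType (toℕ u)) (toℕ v)

  seed : Subset (m * suc d)
  seed = tabulate (uncurry seedCell ∘ remQuot (suc d))

  round : ℕ → Subset (m * suc d)
  round k = iterate grow k seed

  seed-cell : ∀ u v → cell seed u v ≡ seedCell u v
  seed-cell u v = trans (lookup∘tabulate _ (combine u v)) (cong (uncurry seedCell) (remQuot-combine u v))

  seed-row : ∀ {τ} u → rowType (toℕ u) ≡ τ → RowContains seed u (seedRow τ)
  seed-row u refl v in-row = trans (seed-cell u v) in-row

  2+s<n : 2 + s < suc d
  2+s<n = s≤s 2+s≤d

  seedRow-size : ∀ τ → count {suc d} (seedRow τ ∘ toℕ) ≡ 2 + s
  seedRow-size origin = count-<ᵇ (2 + s) (<⇒≤ 2+s<n)
  seedRow-size odd    = count-initialWith (1 + s) (2 + s) (n≤1+n _) 2+s<n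
  seedRow-size even   = trans (count-∨-≡ᵇ (initialWith s (1 + s)) d ≤-refl d∉)
                              (cong suc (count-initialWith s (1 + s) (n≤1+n s) (<-trans (n<1+n _) 2+s<n)))
    where
    d∉ : initialWith s (1 + s) d ≡ false
    d∉ = initialWith-false (≤-trans (n≤1+n s) (≤-trans (n≤1+n _) 2+s≤d)) (>⇒≢ 2+s≤d)

  seed-size : ∣ seed ∣ ≡ m * (2 + s)
  seed-size = begin
    ∣ seed ∣                                ≡⟨ ∣∣≡sum-rows seed ⟩
    sum (λ u → count (cell seed u))         ≡⟨ sum-cong-≗ seed-row-size ⟩
    sum {m} (λ _ → 2 + s)                   ≡⟨ sum-const m (2 + s) ⟩
    m * (2 + s)                             ∎
    where
    open ≡-Reasoning
    seed-row-size : ∀ u → count (cell seed u) ≡ 2 + s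
    seed-row-size u = trans (count-cong (seed-cell u)) (seedRow-size (rowType (toℕ u)))

  neighbour-type≢ : ∀ {τ} u u' → cycleAdj m u u' ≡ true → rowType (toℕ u) ≡ τ → rowType (toℕ u') ≢ τ
  neighbour-type≢ u u' adj refl = rowType-proper 1≢m (toℕ u) (toℕ u') adj ∘ sym

  seed-column-full : ∀ u v {τ} → rowType (toℕ u) ≡ τ → (∀ τ' → τ' ≢ τ → seedRow τ' (toℕ v) ≡ true) →
                     2 ≤ columnCount seed u v
  seed-column-full u v type-u others = ≤-reflexive (sym (columnCount-full seed u v in-seed))
    where
    in-seed : ∀ u' → cycleAdj m u u' ≡ true → cell seed u' v ≡ true
    in-seed u' adj = trans (seed-cell u' v) (others _ (neighbour-type≢ u u' adj type-u))

  seedRow-1+s : ∀ τ → τ ≢ odd → seedRow τ (1 + s) ≡ true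
  seedRow-1+s origin _     = <ᵇ-true (n<1+n (1 + s))
  seedRow-1+s odd    ≢odd  = ⊥-elim (≢odd refl)
  seedRow-1+s even   _     rewrite initialWith-true {s} {1 + s} (inj₂ refl) = refl

  seedRow-s : ∀ τ → τ ≢ even → seedRow τ s ≡ true
  seedRow-s origin _     = <ᵇ-true (≤-trans (n<1+n s) (n≤1+n _))
  seedRow-s odd    _     = initialWith-true (inj₁ (n<1+n s))
  seedRow-s even   ≢even = ⊥-elim (≢even refl)

  seedRow-even-true : ∀ {i} → i < 2 + s ⊎ i ≡ d → i ≢ s → seedRow even i ≡ true
  seedRow-even-true (inj₁ i<2+s) i≢s rewrite initialWith-true (<2+-skip i<2+s i≢s) = refl
  seedRow-even-true {i} (inj₂ refl) _ rewrite ≡ᵇ-true (refl {x = i}) = ∨-zeroʳ _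

  round₁-odd : ∀ u v → rowType (toℕ u) ≡ odd → toℕ v < 3 + s → cell (round 1) u v ≡ true
  round₁-odd u v odd-u v<3+s with toℕ v ≟ℕ 1 + s
  ... | yes v≡1+s = grow-fills seed u v (seedRow odd) 2 (seed-row u odd-u) (seedRow-size odd)
        (seed-column-full u v odd-u λ τ ≢odd → subst (λ i → seedRow τ i ≡ true) (sym v≡1+s) (seedRow-1+s τ ≢odd))
        ≤-refl
  ... | no  v≢1+s = grow-extensive seed u v (seed-row u odd-u v (initialWith-true (<2+-skip v<3+s v≢1+s)))

  round₁-even : ∀ u v → rowType (toℕ u) ≡ even → toℕ v < 2 + s ⊎ toℕ v ≡ d → cell (round 1) u v ≡ true
  round₁-even u v even-u range with toℕ v ≟ℕ s
  ... | yes v≡s = grow-fills seed u v (seedRow even) 2 (seed-row u even-u) (seedRow-size even)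
        (seed-column-full u v even-u λ τ ≢even → subst (λ i → seedRow τ i ≡ true) (sym v≡s) (seedRow-s τ ≢even))
        ≤-refl
  ... | no  v≢s = grow-extensive seed u v (seed-row u even-u v (seedRow-even-true range v≢s))

  round₂-odd : ∀ u v → rowType (toℕ u) ≡ odd → toℕ v < 3 + s ⊎ toℕ v ≡ d → cell (round 2) u v ≡ true
  round₂-odd u v odd-u (inj₁ v<3+s) = grow-extensive (round 1) u v (round₁-odd u v odd-u v<3+s)
  round₂-odd u v odd-u (inj₂ v≡d) with neighbour-of-swapped-type 3≤m u (subst (_≢ origin) (sym odd-u) λ ())
  ... | u' , adj , type-u' = grow-fills (round 1) u v (_<ᵇ 3 + s) 1
        (λ v' v'<3+s → round₁-odd u v' odd-u (<ᵇ-sound v'<3+s)) (count-<ᵇ (3 + s) 2+s<n)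
        (columnCount-pos (round 1) u v u' adj (round₁-even u' v (trans type-u' (cong swap odd-u)) (inj₂ v≡d)))
        ≤-refl

  round₂-even : ∀ u v → rowType (toℕ u) ≡ even → toℕ v < 3 + s ⊎ toℕ v ≡ d → cell (round 2) u v ≡ true
  round₂-even u v even-u range with toℕ v ≟ℕ 2 + s
  ... | yes v≡2+s with neighbour-of-swapped-type 3≤m u (subst (_≢ origin) (sym even-u) λ ())
  ...   | u' , adj , type-u' = grow-fills (round 1) u v (initialWith (2 + s) d) 1
          (λ v' in-P → round₁-even u v' even-u (initialWith-cases _ _ _ in-P))
          (count-initialWith (2 + s) d 2+s≤d ≤-refl)
          (columnCount-pos (round 1) u v u' adj
            (round₁-odd u' v (trans type-u' (cong swap even-u)) (≤-reflexive (cong suc v≡2+s))))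
          ≤-refl
  round₂-even u v even-u range | no v≢2+s = grow-extensive (round 1) u v (round₁-even u v even-u (narrow range))
    where
    narrow : toℕ v < 3 + s ⊎ toℕ v ≡ d → toℕ v < 2 + s ⊎ toℕ v ≡ d
    narrow (inj₂ v≡d) = inj₂ v≡d
    narrow (inj₁ v<3+s) with m<1+n⇒m<n∨m≡n v<3+s
    ... | inj₁ v<2+s = inj₁ v<2+s
    ... | inj₂ v≡2+s = ⊥-elim (v≢2+s v≡2+s)

  round₂ : ∀ u v → rowType (toℕ u) ≢ origin → toℕ v < 3 + s ⊎ toℕ v ≡ d → cell (round 2) u v ≡ true
  round₂ u v ≢origin range with rowType (toℕ u) in type-u
  ... | origin = ⊥-elim (≢origin refl)
  ... | odd    = round₂-odd u v type-u range
  ... | even   = round₂-even u v type-u range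

  -- A column outside {0,…,2+s} ∪ {d} exists only if d ≥ 3+s, and then that set has t columns.
  round₃ : ∀ u v → rowType (toℕ u) ≢ origin → cell (round 3) u v ≡ true
  round₃ u v ≢origin with toℕ v <? 3 + s
  ... | yes v<3+s = grow-extensive (round 2) u v (round₂ u v ≢origin (inj₁ v<3+s))
  ... | no  v≮3+s = grow-fills (round 2) u v (initialWith (3 + s) d) 0
        (λ v' in-P → round₂ u v' ≢origin (initialWith-cases _ _ _ in-P))
        (count-initialWith (3 + s) d (≤-trans (≮⇒≥ v≮3+s) (≤-pred (toℕ<n v))) ≤-refl) z≤n ≤-refl

  round₄ : ∀ u v → cell (round 4) u v ≡ true
  round₄ u v with rowType (toℕ u) in type-u
  ... | origin = grow-fills (round 3) u v (seedRow origin) 2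
        (λ v' in-row → iterate-extensive (C m □ K (suc d)) (4 + s) 3 seed (combine u v') (seed-row u type-u v' in-row))
        (seedRow-size origin)
        (≤-reflexive (sym (columnCount-full (round 3) u v λ u' adj → round₃ u' v (neighbour-type≢ u u' adj type-u))))
        ≤-refl
  ... | odd    = grow-extensive (round 3) u v (round₃ u v (subst (_≢ origin) (sym type-u) λ ()))
  ... | even   = grow-extensive (round 3) u v (round₃ u v (subst (_≢ origin) (sym type-u) λ ()))

  seed-monopoly : IsDynMonopoly (C m □ K (suc d)) (4 + s) seed
  seed-monopoly x = subst (λ y → lookup (closure (C m □ K (suc d)) (4 + s) seed) y ≡ true)
    (combine-remQuot {m} (suc d) x) (closure-⊇-iterate (C m □ K (suc d)) (4 + s) 4 seed _ 4≤V (round₄ _ _))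
    where
    4≤V : 4 ≤ m * suc d
    4≤V = ≤-trans (s≤s (s≤s (s≤s (s≤s z≤n)))) (*-mono-≤ 3≤m (s≤s (≤-trans (s≤s (s≤s z≤n)) 2+s≤d)))

-- The hypothesis 1 ≤ n is implied by 4 ≤ t and t ∸ 1 ≤ n.
theorem8 : (m n t : ℕ) → 3 ≤ m → 1 ≤ n → 4 ≤ t → t ∸ 1 ≤ n →
    DynEq (C m □ K n) t (m * (t ∸ 2))
theorem8 m zero    (suc (suc (suc (suc s)))) _   _ (s≤s (s≤s (s≤s (s≤s _)))) ()
theorem8 m (suc d) (suc (suc (suc (suc s)))) 3≤m _ (s≤s (s≤s (s≤s (s≤s _)))) (s≤s 2+s≤d) =
  (seed , seed-monopoly , seed-size) , λ D monopoly → monopoly-size D (≤-trans 2+s≤d (n≤1+n d)) monopoly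
  where
  open Process m (suc d) (4 + s) 3≤m
  open Construction m d s 3≤m 2+s≤d
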